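{- Let $P$ be a bounded, ranked poset of length $n$. For $1\le i\le n$, \[\mu\big(\widehat{I_{i-1}(P)}\big)=\sum_{(a,x_i)\in R_i(P^\ast)}\mu_{R_i(P^\ast)}\big((\hat1_P,x_0),(a,x_i)\big),\] where the sum is over all elements of $R_i(P^\ast)$ whose second coordinate is $x_i$.
   Context: $P^\ast$ is the dual of $P$ (so $\hat1_P$ is its minimum). For ranked $P,Q$ the Rees product is $P\ast Q=\{(p,q): r_P(p)\ge r_Q(q)\}$ with $(p_1,q_1)\le(p_2,q_2)$ iff $p_1\le p_2$, $q_1\le q_2$, $r_P(p_2)-r_P(p_1)\ge r_Q(q_2)-r_Q(q_1)$. For a bounded ranked poset $X$ of length $n$: $X^-=X\setminus\{\hat0_X\}$; $C_n$ is the chain $0<\dots<n-1$; $I_j(X)=\{z\in X^-\ast C_n: z<(\hat1_X,j)\}$; $R(X)=X\ast\{x_0<x_1<\dots<x_n\}$; $R_i(X)$ is the closed lower order ideal of $R(X)$ generated by $(\hat1_X,x_i)$. $\widehat Y$ is $Y$ with new minimum and maximum adjoined, $\mu(B)=\mu_B(\hat0_B,\hat1_B)$, and $\mu_{R_i(P^\ast)}$ is the Möbius function of $R_i(P^\ast)$. -}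

module Defs where

open import Data.Nat as ℕ using (ℕ; zero; suc; _+_; _∸_; _≤_; _≤?_)
open import Data.Integer as ℤ using (ℤ; 0ℤ; 1ℤ; -_)
open import Data.List using (List; []; _∷_; map; filter; cartesianProduct; upTo; length; foldr)
open import Data.Empty using (⊥)
open import Data.Product using (Σ; _×_; _,_; proj₁; proj₂)
open import Data.Product.Properties using (≡-dec)
open import Relation.Nullary using (¬_; Dec; yes; no)
open import Relation.Nullary.Decidable using (_×-dec_; ¬?)
open import Relation.Binary using (Decidable; DecidableEquality; IsPartialOrder)
open import Relation.Binary.PropositionalEquality using (_≡_; refl)
open import Data.List.Membership.Propositional using (_∈_)
open import Data.List.Relation.Unary.Unique.Propositional using (Unique)

sumℤ : List ℤ → ℤ
sumℤ = foldr ℤ._+_ 0ℤ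

record FinOrd : Set₁ where
  field
    Carrier : Set
    _≼_     : Carrier → Carrier → Set
    _≼?_    : Decidable _≼_
    _≟_     : DecidableEquality Carrier
    elems   : List Carrier

  _≺_ : Carrier → Carrier → Set
  x ≺ y = (x ≼ y) × ¬ (x ≡ y)

  _≺?_ : Decidable _≺_
  x ≺? y = (x ≼? y) ×-dec ¬? (x ≟ y)

open FinOrd public

-- Möbius function via the defining recursion
--   μ(x,x) = 1,  μ(x,y) = - Σ_{x ≤ z < y} μ(x,z) for x < y,  μ(x,y) = 0 otherwise,
-- computed with a fuel bound (one more than the number of elements, which
-- exceeds the length of every chain, so the fuel never runs out on a poset).
module _ (X : FinOrd) where
  private
    _le?_ = _≼?_ X
    _lt?_ = _≺?_ X
    _eq?_ = _≟_ X

  mobiusFuel : ℕ → Carrier X → Carrier X → ℤ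
  mobiusFuel zero x y = 0ℤ
  mobiusFuel (suc k) x y with x eq? y
  ... | yes _ = 1ℤ
  ... | no _ with x le? y
  ...   | no _ = 0ℤ
  ...   | yes _ = - sumℤ (map (mobiusFuel k x)
                          (filter (λ z → (x le? z) ×-dec (z lt? y)) (elems X)))

  mobius : Carrier X → Carrier X → ℤ
  mobius = mobiusFuel (suc (length (elems X)))

_⋖_ : (X : FinOrd) → Carrier X → Carrier X → Set
_⋖_ X x y = _≺_ X x y × (∀ z → _≺_ X x z → _≺_ X z y → ⊥)

record BoundedRankedPoset : Set₁ where
  field
    ord      : FinOrd
  field
    complete : ∀ x → x ∈ elems ord
    unique   : Unique (elems ord)
    isPO     : IsPartialOrder _≡_ (_≼_ ord)
    bot top  : Carrier ord
    bot-min  : ∀ x → _≼_ ord bot x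
    top-max  : ∀ x → _≼_ ord x top
    rank     : Carrier ord → ℕ
    rank-bot : rank bot ≡ 0
    rank-cov : ∀ x y → _⋖_ ord x y → rank y ≡ suc (rank x)

  len : ℕ
  len = rank top

record RFinOrd : Set₁ where
  field
    ord  : FinOrd
    rk   : Carrier ord → ℕ
    bot  : Carrier ord
    top  : Carrier ord

toR : BoundedRankedPoset → RFinOrd
toR P = record { ord = ord ; rk = rank ; bot = bot ; top = top }
  where open BoundedRankedPoset P

dualR : BoundedRankedPoset → RFinOrd
dualR P = record
  { ord = record { Carrier = Carrier ord ; _≼_ = λ x y → _≼_ ord y x
                 ; _≼?_ = λ x y → _≼?_ ord y x ; _≟_ = _≟_ ord ; elems = elems ord }
  ; rk = λ p → len ∸ rank p ; bot = top ; top = bot }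
  where open BoundedRankedPoset P

minusR : RFinOrd → RFinOrd
minusR X = record
  { ord = record { Carrier = Carrier o ; _≼_ = _≼_ o ; _≼?_ = _≼?_ o ; _≟_ = _≟_ o
                 ; elems = filter (λ x → ¬? (_≟_ o x (RFinOrd.bot X))) (elems o) }
  ; rk = λ x → RFinOrd.rk X x ∸ 1 ; bot = RFinOrd.bot X ; top = RFinOrd.top X }
  where o = RFinOrd.ord X

chainR : ℕ → RFinOrd
chainR m = record
  { ord = record { Carrier = ℕ ; _≼_ = _≤_ ; _≼?_ = _≤?_ ; _≟_ = ℕ._≟_ ; elems = upTo m }
  ; rk = λ j → j ; bot = 0 ; top = m ∸ 1 }

rees : RFinOrd → RFinOrd → FinOrd
rees X Y = record
  { Carrier = Carrier oX × Carrier oY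
  ; _≼_ = λ { (p₁ , q₁) (p₂ , q₂) →
        _≼_ oX p₁ p₂ × _≼_ oY q₁ q₂ × (rY q₂ + rX p₁ ≤ rX p₂ + rY q₁) }
  ; _≼?_ = λ { (p₁ , q₁) (p₂ , q₂) →
        _≼?_ oX p₁ p₂ ×-dec (_≼?_ oY q₁ q₂ ×-dec (rY q₂ + rX p₁ ≤? rX p₂ + rY q₁)) }
  ; _≟_ = ≡-dec (_≟_ oX) (_≟_ oY)
  ; elems = filter (λ z → rY (proj₂ z) ≤? rX (proj₁ z)) (cartesianProduct (elems oX) (elems oY))
  }
  where
    oX = RFinOrd.ord X
    oY = RFinOrd.ord Y
    rX = RFinOrd.rk X
    rY = RFinOrd.rk Y

sub : (X : FinOrd) {Q : Carrier X → Set} → (∀ x → Dec (Q x)) → FinOrd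
sub X Q? = record { Carrier = Carrier X ; _≼_ = _≼_ X ; _≼?_ = _≼?_ X ; _≟_ = _≟_ X
                  ; elems = filter Q? (elems X) }

Iposet : RFinOrd → ℕ → FinOrd
Iposet X j = sub R (λ z → _≺?_ R z (RFinOrd.top X , j))
  where R = rees (minusR X) (chainR (RFinOrd.rk X (RFinOrd.top X)))

-- R(X) = X ∗ {x₀ < ... < xₙ}, with x_j represented by j.
Rposet : RFinOrd → FinOrd
Rposet X = rees X (chainR (suc (RFinOrd.rk X (RFinOrd.top X))))

Riposet : RFinOrd → ℕ → FinOrd
Riposet X i = sub (Rposet X) (λ z → _≼?_ (Rposet X) z (RFinOrd.top X , i))

data Hat (C : Set) : Set where
  hbot htop : Hat C
  inn       : C → Hat C

module _ (X : FinOrd) where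
  data HatLe : Hat (Carrier X) → Hat (Carrier X) → Set where
    bot≤ : ∀ {z} → HatLe hbot z
    ≤top : ∀ {z} → HatLe z htop
    inn≤ : ∀ {a b} → _≼_ X a b → HatLe (inn a) (inn b)

  hatLe? : Decidable HatLe
  hatLe? hbot z = yes bot≤
  hatLe? htop htop = yes ≤top
  hatLe? htop hbot = no (λ ())
  hatLe? htop (inn _) = no (λ ())
  hatLe? (inn a) htop = yes ≤top
  hatLe? (inn a) hbot = no (λ ())
  hatLe? (inn a) (inn b) with _≼?_ X a b
  ... | yes p = yes (inn≤ p)
  ... | no ¬p = no (λ { (inn≤ p) → ¬p p })

  hatEq? : DecidableEquality (Hat (Carrier X))
  hatEq? hbot hbot = yes refl
  hatEq? hbot htop = no (λ ())
  hatEq? hbot (inn _) = no (λ ())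
  hatEq? htop hbot = no (λ ())
  hatEq? htop htop = yes refl
  hatEq? htop (inn _) = no (λ ())
  hatEq? (inn _) hbot = no (λ ())
  hatEq? (inn _) htop = no (λ ())
  hatEq? (inn a) (inn b) with _≟_ X a b
  ... | yes refl = yes refl
  ... | no ¬p = no (λ { refl → ¬p refl })

hat : FinOrd → FinOrd
hat X = record { Carrier = Hat (Carrier X) ; _≼_ = HatLe X ; _≼?_ = hatLe? X
               ; _≟_ = hatEq? X ; elems = hbot ∷ htop ∷ map inn (elems X) }

μhat : FinOrd → ℤ
μhat Y = mobius (hat Y) hbot htop

module Submission where

-- Proof of Corollary 4.4.  Fix P of length n and 1 ≤ i ≤ n; let Q = R_i(P*) with
-- minimum b = (1̂_P , x₀) and maximum t = (0̂_P , x_i), I = I_{i-1}(P), and μ* the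
-- Möbius function of the dual of Î taken from its minimum (the top of Î).
-- The reflection φ(a , j) = (a , i-1-j) is an order-reversing bijection from
-- Q' = { (a , j) ∈ Q : j < i , (a , j) ≠ b } onto I, so by uniqueness of solutions
-- of the Möbius recursion μ_Q(b , z) = μ*(φ z) on Q'.  As b < t bound Q, the
-- values μ_Q(b , ·) sum to 0; splitting Q into {b}, Q' and the level j = i gives
-- 1 + Y + R = 0, where Y = Σ_{w ∈ I} μ*(w) and R is the right-hand side.  The
-- same vanishing sum in the dual of Î, with the duality μ_Î(0̂ , 1̂) = μ*(0̂),
-- gives μ(Î) = -(1 + Y) = R.

open import Defs
open import Data.Nat using (ℕ; _≤_; _∸_)
open import Data.Nat.Properties using () renaming (_≟_ to _≟ℕ_)
open import Data.List using (map; filter)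
open import Data.Product using (_,_; proj₂)
open import Relation.Binary.PropositionalEquality using (_≡_)

open import Data.Nat using (zero; suc; _+_; _<_; z≤n; s≤s; _≤?_; _<?_)
import Data.Nat.Properties as ℕP
open import Data.Nat.Tactic.RingSolver using (solve-∀)
open import Data.Integer using (ℤ; 0ℤ; 1ℤ; -_) renaming (_+_ to _+ᶻ_; _*_ to _*ᶻ_)
import Data.Integer.Properties as ℤP
open import Data.List using (List; []; _∷_; _++_; length; cartesianProduct; upTo; applyUpTo)
open import Data.List.Properties using (length-filter)
open import Data.List.Membership.Propositional using (_∈_)
open import Data.List.Membership.Propositional.Properties
  using (∈-filter⁺; ∈-filter⁻; ∈-cartesianProduct⁺; ∈-upTo⁺; ∈-map⁻)
open import Data.List.Relation.Unary.Any using (here; there)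
import Data.List.Relation.Unary.All as All
open import Data.List.Relation.Unary.AllPairs using (_∷_)
open import Data.List.Relation.Unary.Unique.Propositional using (Unique)
import Data.List.Relation.Unary.Unique.Propositional.Properties as Unique
open import Data.Product using (_×_; proj₁)
open import Data.Empty using (⊥; ⊥-elim)
open import Relation.Nullary using (¬_; Dec; yes; no)
open import Relation.Nullary.Decidable using (_×-dec_; ¬?)
open import Relation.Binary using (IsPartialOrder; DecidableEquality)
open import Relation.Binary.PropositionalEquality
  using (refl; sym; trans; cong; cong₂; subst; subst₂; isEquivalence)
open import Function.Bundles using (_⇔_; mk⇔; Equivalence)
open import Algebra.Bundles using (AbelianGroup)
open import Algebra.Properties.Group (AbelianGroup.group ℤP.+-0-abelianGroup) using (inverseˡ-unique)
open import Algebra.Properties.CommutativeSemigroup ℤP.+-commutativeSemigroup using (interchange)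
open Relation.Binary.PropositionalEquality.≡-Reasoning

private variable
  A B : Set
  Φ Ψ : Set
  u v : ℤ

∑ : List A → (A → ℤ) → ℤ
∑ L f = sumℤ (map f L)

ind : Dec Φ → ℤ → ℤ
ind (yes _) u = u
ind (no _)  _ = 0ℤ

ind-yes : (d : Dec Φ) → Φ → ind d u ≡ u
ind-yes (yes _) _ = refl
ind-yes (no ¬φ) φ = ⊥-elim (¬φ φ)

ind-no : (d : Dec Φ) → ¬ Φ → ind d u ≡ 0ℤ
ind-no (yes φ) ¬φ = ⊥-elim (¬φ φ)
ind-no (no _)  _  = refl

ind-0 : (d : Dec Φ) → ind d 0ℤ ≡ 0ℤ
ind-0 (yes _) = refl
ind-0 (no _)  = refl

ind-cong : (d : Dec Φ) (e : Dec Ψ) → (Φ → Ψ) → (Ψ → Φ) → (Φ → u ≡ v) → ind d u ≡ ind e v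
ind-cong (yes φ) (yes _) _ _ h = h φ
ind-cong (yes φ) (no ¬ψ) f _ _ = ⊥-elim (¬ψ (f φ))
ind-cong (no ¬φ) (yes ψ) _ g _ = ⊥-elim (¬φ (g ψ))
ind-cong (no _)  (no _)  _ _ _ = refl

ind-and : (d : Dec Φ) (e : Dec Ψ) (w : ℤ) → ind d (ind e w) ≡ ind (d ×-dec e) w
ind-and (yes _) (yes _) _ = refl
ind-and (yes _) (no _)  _ = refl
ind-and (no _)  (yes _) _ = refl
ind-and (no _)  (no _)  _ = refl

ind-*ˡ : (d : Dec Φ) (c w : ℤ) → c *ᶻ ind d w ≡ ind d (c *ᶻ w)
ind-*ˡ (yes _) c w = refl
ind-*ˡ (no _)  c w = ℤP.*-zeroʳ c

ind-*ʳ : (d : Dec Φ) (c w : ℤ) → ind d w *ᶻ c ≡ ind d (w *ᶻ c)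
ind-*ʳ (yes _) c w = refl
ind-*ʳ (no _)  c w = ℤP.*-zeroˡ c

∑-cong : (L : List A) {f g : A → ℤ} → (∀ z → z ∈ L → f z ≡ g z) → ∑ L f ≡ ∑ L g
∑-cong []      h = refl
∑-cong (x ∷ L) h = cong₂ _+ᶻ_ (h x (here refl)) (∑-cong L (λ z z∈ → h z (there z∈)))

∑-zero : (L : List A) (f : A → ℤ) → (∀ z → z ∈ L → f z ≡ 0ℤ) → ∑ L f ≡ 0ℤ
∑-zero []      f h = refl
∑-zero (x ∷ L) f h = cong₂ _+ᶻ_ (h x (here refl)) (∑-zero L f (λ z z∈ → h z (there z∈)))

∑-+ : (L : List A) (f g : A → ℤ) → ∑ L (λ z → f z +ᶻ g z) ≡ ∑ L f +ᶻ ∑ L g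
∑-+ []      f g = refl
∑-+ (x ∷ L) f g = trans (cong (f x +ᶻ g x +ᶻ_) (∑-+ L f g)) (interchange (f x) (g x) (∑ L f) (∑ L g))

∑-*ˡ : (L : List A) (c : ℤ) (f : A → ℤ) → c *ᶻ ∑ L f ≡ ∑ L (λ z → c *ᶻ f z)
∑-*ˡ []      c f = ℤP.*-zeroʳ c
∑-*ˡ (x ∷ L) c f = trans (ℤP.*-distribˡ-+ c (f x) (∑ L f)) (cong (c *ᶻ f x +ᶻ_) (∑-*ˡ L c f))

∑-*ʳ : (L : List A) (c : ℤ) (f : A → ℤ) → ∑ L f *ᶻ c ≡ ∑ L (λ z → f z *ᶻ c)
∑-*ʳ L c f = begin
  ∑ L f *ᶻ c               ≡⟨ ℤP.*-comm (∑ L f) c ⟩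
  c *ᶻ ∑ L f               ≡⟨ ∑-*ˡ L c f ⟩
  ∑ L (λ z → c *ᶻ f z)     ≡⟨ ∑-cong L (λ z _ → ℤP.*-comm c (f z)) ⟩
  ∑ L (λ z → f z *ᶻ c)     ∎

∑-ind : (d : Dec Φ) (L : List A) (f : A → ℤ) → ind d (∑ L f) ≡ ∑ L (λ z → ind d (f z))
∑-ind (yes _) L f = refl
∑-ind (no _)  L f = sym (∑-zero L _ (λ _ _ → refl))

∑-filter : {P : A → Set} (p : ∀ x → Dec (P x)) (L : List A) (f : A → ℤ) →
  ∑ (filter p L) f ≡ ∑ L (λ z → ind (p z) (f z))
∑-filter p []      f = refl
∑-filter p (x ∷ L) f with p x
... | yes _ = cong (f x +ᶻ_) (∑-filter p L f)
... | no _  = trans (∑-filter p L f) (sym (ℤP.+-identityˡ _))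

∑-++ : (xs ys : List A) (f : A → ℤ) → ∑ (xs ++ ys) f ≡ ∑ xs f +ᶻ ∑ ys f
∑-++ []       ys f = sym (ℤP.+-identityˡ _)
∑-++ (x ∷ xs) ys f = trans (cong (f x +ᶻ_) (∑-++ xs ys f)) (sym (ℤP.+-assoc (f x) (∑ xs f) (∑ ys f)))

∑-map : (L : List A) (h : A → B) (f : B → ℤ) → ∑ (map h L) f ≡ ∑ L (λ z → f (h z))
∑-map []      h f = refl
∑-map (x ∷ L) h f = cong (f (h x) +ᶻ_) (∑-map L h f)

∑-swap : (L : List A) (M : List B) (g : A → B → ℤ) →
  ∑ L (λ a → ∑ M (g a)) ≡ ∑ M (λ b → ∑ L (λ a → g a b))
∑-swap []      M g = sym (∑-zero M _ (λ _ _ → refl))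
∑-swap (x ∷ L) M g = trans (cong (∑ M (g x) +ᶻ_) (∑-swap L M g))
                           (sym (∑-+ M (g x) (λ b → ∑ L (λ a → g a b))))

∑-cartesianProduct : (xs : List A) (ys : List B) (f : A × B → ℤ) →
  ∑ (cartesianProduct xs ys) f ≡ ∑ xs (λ a → ∑ ys (λ b → f (a , b)))
∑-cartesianProduct []       ys f = refl
∑-cartesianProduct (x ∷ xs) ys f = trans (∑-++ (map (x ,_) ys) _ f)
  (cong₂ _+ᶻ_ (∑-map ys (x ,_) f) (∑-cartesianProduct xs ys f))

∑-single : (L : List A) (f : A → ℤ) (y : A) → Unique L → y ∈ L →
  (∀ z → z ∈ L → ¬ z ≡ y → f z ≡ 0ℤ) → ∑ L f ≡ f y
∑-single (x ∷ L) f y (x∉L ∷ uL) (here refl) h = begin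
  f x +ᶻ ∑ L f  ≡⟨ cong (f x +ᶻ_) (∑-zero L f (λ z z∈ → h z (there z∈) (λ { refl → All.lookup x∉L z∈ refl }))) ⟩
  f x +ᶻ 0ℤ     ≡⟨ ℤP.+-identityʳ (f x) ⟩
  f x           ∎
∑-single (x ∷ L) f y (x∉L ∷ uL) (there y∈) h = begin
  f x +ᶻ ∑ L f  ≡⟨ cong (_+ᶻ ∑ L f) (h x (here refl) (λ { refl → All.lookup x∉L y∈ refl })) ⟩
  0ℤ +ᶻ ∑ L f   ≡⟨ ℤP.+-identityˡ (∑ L f) ⟩
  ∑ L f         ≡⟨ ∑-single L f y uL y∈ (λ z z∈ → h z (there z∈)) ⟩
  f y           ∎

∑-at : (_≟_ : DecidableEquality A) (L : List A) (f : A → ℤ) (y : A) → Unique L → y ∈ L →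
  ∑ L (λ z → ind (z ≟ y) (f z)) ≡ f y
∑-at _≟_ L f y uL y∈ = trans (∑-single L _ y uL y∈ (λ z _ z≢y → ind-no (z ≟ y) z≢y)) (ind-yes (y ≟ y) refl)

∑< : ℕ → (ℕ → ℤ) → ℤ
∑< zero    h = 0ℤ
∑< (suc m) h = ∑< m h +ᶻ h m

∑<-cong : (m : ℕ) {f g : ℕ → ℤ} → (∀ j → j < m → f j ≡ g j) → ∑< m f ≡ ∑< m g
∑<-cong zero    h = refl
∑<-cong (suc m) h = cong₂ _+ᶻ_ (∑<-cong m (λ j j<m → h j (ℕP.m<n⇒m<1+n j<m))) (h m ℕP.≤-refl)

∑<-ind : (d : Dec Φ) (m : ℕ) (f : ℕ → ℤ) → ind d (∑< m f) ≡ ∑< m (λ j → ind d (f j))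
∑<-ind (yes _) m       f = refl
∑<-ind (no _)  zero    f = refl
∑<-ind (no ¬φ) (suc m) f = cong (_+ᶻ 0ℤ) (∑<-ind (no ¬φ) m f)

∑<-front : (m : ℕ) (h : ℕ → ℤ) → ∑< (suc m) h ≡ h 0 +ᶻ ∑< m (λ j → h (suc j))
∑<-front zero    h = ℤP.+-comm 0ℤ (h 0)
∑<-front (suc m) h = trans (cong (_+ᶻ h (suc m)) (∑<-front m h)) (ℤP.+-assoc (h 0) _ _)

∑-applyUpTo : (m : ℕ) (g : ℕ → ℕ) (f : ℕ → ℤ) → ∑ (applyUpTo g m) f ≡ ∑< m (λ j → f (g j))
∑-applyUpTo zero    g f = refl
∑-applyUpTo (suc m) g f = trans (cong (f (g 0) +ᶻ_) (∑-applyUpTo m (λ j → g (suc j)) f))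
                                (sym (∑<-front m (λ j → f (g j))))

∑-upTo : (m : ℕ) (f : ℕ → ℤ) → ∑ (upTo m) f ≡ ∑< m f
∑-upTo m f = ∑-applyUpTo m (λ j → j) f

∑<-truncate : (i m : ℕ) (f : ℕ → ℤ) → i ≤ m → (∀ j → i ≤ j → f j ≡ 0ℤ) → ∑< m f ≡ ∑< i f
∑<-truncate i zero    f z≤n h = refl
∑<-truncate i (suc m) f i≤m h with i ≟ℕ suc m
... | yes refl = refl
... | no  i≢m  = trans (cong₂ _+ᶻ_ (∑<-truncate i m f i≤m' h) (h m i≤m')) (ℤP.+-identityʳ _)
  where i≤m' = ℕP.≤-pred (ℕP.≤∧≢⇒< i≤m i≢m)

∑<-reverse : (m : ℕ) (h : ℕ → ℤ) → ∑< m (λ j → h (m ∸ suc j)) ≡ ∑< m h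
∑<-reverse zero    h = refl
∑<-reverse (suc m) h = begin
  ∑< (suc m) (λ j → h (suc m ∸ suc j))  ≡⟨ ∑<-front m _ ⟩
  h m +ᶻ ∑< m (λ j → h (m ∸ suc j))     ≡⟨ cong (h m +ᶻ_) (∑<-reverse m h) ⟩
  h m +ᶻ ∑< m h                         ≡⟨ ℤP.+-comm (h m) _ ⟩
  ∑< (suc m) h                          ∎

-- Möbius theory of a finite partial order.

btw? : (X : FinOrd) (x y : Carrier X) → ∀ z → Dec (_≼_ X x z × _≺_ X z y)
btw? X x y z = (_≼?_ X x z) ×-dec (_≺?_ X z y)

length-filter-mono : {P R : A → Set} (p : ∀ x → Dec (P x)) (r : ∀ x → Dec (R x)) (L : List A) →
  (∀ z → z ∈ L → P z → R z) → length (filter p L) ≤ length (filter r L)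
length-filter-mono p r []      h = z≤n
length-filter-mono p r (x ∷ L) h with p x | r x
... | yes px | yes _  = s≤s (length-filter-mono p r L (λ z z∈ → h z (there z∈)))
... | yes px | no ¬rx = ⊥-elim (¬rx (h x (here refl) px))
... | no _   | yes _  = ℕP.m≤n⇒m≤1+n (length-filter-mono p r L (λ z z∈ → h z (there z∈)))
... | no _   | no _   = length-filter-mono p r L (λ z z∈ → h z (there z∈))

length-filter-mono-< : {P R : A → Set} (p : ∀ x → Dec (P x)) (r : ∀ x → Dec (R x)) (L : List A) →
  (∀ z → z ∈ L → P z → R z) → ∀ w → w ∈ L → R w → ¬ P w → length (filter p L) < length (filter r L)
length-filter-mono-< p r (x ∷ L) h w (here refl) rw ¬pw with p x | r x
... | yes px | _      = ⊥-elim (¬pw px)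
... | no _   | yes _  = s≤s (length-filter-mono p r L (λ z z∈ → h z (there z∈)))
... | no _   | no ¬rx = ⊥-elim (¬rx rw)
length-filter-mono-< p r (x ∷ L) h w (there w∈) rw ¬pw with p x | r x
... | yes px | yes _  = s≤s (length-filter-mono-< p r L (λ z z∈ → h z (there z∈)) w w∈ rw ¬pw)
... | yes px | no ¬rx = ⊥-elim (¬rx (h x (here refl) px))
... | no _   | yes _  = ℕP.m≤n⇒m≤1+n (length-filter-mono-< p r L (λ z z∈ → h z (there z∈)) w w∈ rw ¬pw)
... | no _   | no _   = length-filter-mono-< p r L (λ z z∈ → h z (there z∈)) w w∈ rw ¬pw

module Mobius (X : FinOrd) (po : IsPartialOrder _≡_ (_≼_ X)) where
  private
    C = Carrier X
    E = elems X
    _⊑_ = _≼_ X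
    _⊏_ = _≺_ X

  ⊑-refl : ∀ {x} → x ⊑ x
  ⊑-refl = IsPartialOrder.refl po

  ⊑-trans : ∀ {x y z} → x ⊑ y → y ⊑ z → x ⊑ z
  ⊑-trans = IsPartialOrder.trans po

  ⊑-antisym : ∀ {x y} → x ⊑ y → y ⊑ x → x ≡ y
  ⊑-antisym = IsPartialOrder.antisym po

  ⊏-trans : ∀ {x y z} → x ⊏ y → y ⊏ z → x ⊏ z
  ⊏-trans (xy , x≢y) (yz , _) = ⊑-trans xy yz , λ { refl → x≢y (⊑-antisym xy yz) }

  -- The number of elements of [x , y), which shrinks along the recursion.
  size : C → C → ℕ
  size x y = length (filter (btw? X x y) E)

  size-< : ∀ {x y z} → z ∈ E → x ⊑ z → z ⊏ y → size x z < size x y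
  size-< {x} {y} {z} z∈ xz zy = length-filter-mono-< (btw? X x z) (btw? X x y) E
    (λ w _ (xw , wz) → xw , ⊏-trans wz zy) z z∈ (xz , zy) (λ (_ , (_ , z≢z)) → z≢z refl)

  fuel-stable : ∀ k k' x y → size x y < k → size x y < k' → mobiusFuel X k x y ≡ mobiusFuel X k' x y
  fuel-stable (suc k) (suc k') x y h h' with _≟_ X x y
  ... | yes _ = refl
  ... | no _ with _≼?_ X x y
  ...   | no _  = refl
  ...   | yes _ = cong -_ (∑-cong (filter (btw? X x y) E) λ z z∈ →
            let (z∈E , (xz , zy)) = ∈-filter⁻ (btw? X x y) z∈
                lt = size-< z∈E xz zy
            in fuel-stable k k' x z (ℕP.<-≤-trans lt (ℕP.≤-pred h)) (ℕP.<-≤-trans lt (ℕP.≤-pred h')))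

  mobius-refl : ∀ x → mobius X x x ≡ 1ℤ
  mobius-refl x with _≟_ X x x
  ... | yes _   = refl
  ... | no x≢x  = ⊥-elim (x≢x refl)

  mobius-step : ∀ x y → x ⊑ y → ¬ x ≡ y → mobius X x y ≡ - ∑ (filter (btw? X x y) E) (mobius X x)
  mobius-step x y xy x≢y with _≟_ X x y
  ... | yes x≡y = ⊥-elim (x≢y x≡y)
  ... | no _ with _≼?_ X x y
  ...   | no ¬xy = ⊥-elim (¬xy xy)
  ...   | yes _  = cong -_ (∑-cong (filter (btw? X x y) E) λ z z∈ →
            let (z∈E , (xz , zy)) = ∈-filter⁻ (btw? X x y) z∈
                lt = size-< z∈E xz zy
                bound = length-filter (btw? X x y) E
            in fuel-stable (length E) (suc (length E)) x z
                 (ℕP.<-≤-trans lt bound) (ℕP.<-≤-trans lt (ℕP.m≤n⇒m≤1+n bound)))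

  mobius-unique : (x₀ : C) (D : C → Set) (f : C → ℤ) → f x₀ ≡ 1ℤ →
    (∀ y z → D y → z ⊏ y → D z) →
    (∀ y → y ∈ E → D y → x₀ ⊑ y → ¬ x₀ ≡ y → f y ≡ - ∑ (filter (btw? X x₀ y) E) f) →
    ∀ y → y ∈ E → D y → x₀ ⊑ y → f y ≡ mobius X x₀ y
  mobius-unique x₀ D f f₀ D-closed f-step y = by-size (suc (size x₀ y)) y ℕP.≤-refl
    where
    by-size : ∀ k y → size x₀ y < k → y ∈ E → D y → x₀ ⊑ y → f y ≡ mobius X x₀ y
    by-size (suc k) y lt y∈ Dy x₀y = cases (_≟_ X x₀ y)
      where
      cases : Dec (x₀ ≡ y) → f y ≡ mobius X x₀ y
      cases (yes refl) = trans f₀ (sym (mobius-refl x₀))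
      cases (no x₀≢y)  = begin
        f y                                            ≡⟨ f-step y y∈ Dy x₀y x₀≢y ⟩
        - ∑ (filter (btw? X x₀ y) E) f                 ≡⟨ cong -_ (∑-cong (filter (btw? X x₀ y) E) below) ⟩
        - ∑ (filter (btw? X x₀ y) E) (mobius X x₀)     ≡⟨ sym (mobius-step x₀ y x₀y x₀≢y) ⟩
        mobius X x₀ y                                  ∎
        where
        below : ∀ z → z ∈ filter (btw? X x₀ y) E → f z ≡ mobius X x₀ z
        below z z∈ = let (z∈E , (x₀z , zy)) = ∈-filter⁻ (btw? X x₀ y) z∈
                     in by-size k z (ℕP.<-≤-trans (size-< z∈E x₀z zy) (ℕP.≤-pred lt)) z∈E (D-closed y z Dy zy) x₀z

  δ : C → C → ℤ
  δ x z = ind (_≟_ X x z) 1ℤ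

  mobius-interval-sum : Unique E → ∀ x z → z ∈ E → x ⊑ z →
    ∑ E (λ w → ind ((_≼?_ X x w) ×-dec (_≼?_ X w z)) (mobius X x w)) ≡ δ x z
  mobius-interval-sum uE x z z∈ xz = begin
    ∑ E (λ w → ind ((_≼?_ X x w) ×-dec (_≼?_ X w z)) (μ w))
      ≡⟨ ∑-cong E (λ w _ → closed≡half-open+end w) ⟩
    ∑ E (λ w → ind (btw? X x z w) (μ w) +ᶻ ind (_≟_ X w z) (μ w))
      ≡⟨ ∑-+ E _ _ ⟩
    ∑ E (λ w → ind (btw? X x z w) (μ w)) +ᶻ ∑ E (λ w → ind (_≟_ X w z) (μ w))
      ≡⟨ cong₂ _+ᶻ_ (sym (∑-filter (btw? X x z) E μ)) (∑-at (_≟_ X) E μ z uE z∈) ⟩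
    ∑ (filter (btw? X x z) E) μ +ᶻ μ z
      ≡⟨ end-term (_≟_ X x z) ⟩
    δ x z ∎
    where
    μ = mobius X x

    closed≡half-open+end : ∀ w → ind ((_≼?_ X x w) ×-dec (_≼?_ X w z)) (μ w)
                               ≡ ind (btw? X x z w) (μ w) +ᶻ ind (_≟_ X w z) (μ w)
    closed≡half-open+end w = cases (_≟_ X w z)
      where
      cases : Dec (w ≡ z) → ind ((_≼?_ X x w) ×-dec (_≼?_ X w z)) (μ w)
                          ≡ ind (btw? X x z w) (μ w) +ᶻ ind (_≟_ X w z) (μ w)
      cases (yes refl) = begin
        ind ((_≼?_ X x w) ×-dec (_≼?_ X w w)) (μ w)   ≡⟨ ind-yes ((_≼?_ X x w) ×-dec (_≼?_ X w w)) (xz , ⊑-refl) ⟩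
        μ w                                           ≡⟨ sym (ℤP.+-identityˡ (μ w)) ⟩
        0ℤ +ᶻ μ w
          ≡⟨ cong₂ _+ᶻ_ (sym (ind-no (btw? X x w w) (λ (_ , (_ , w≢w)) → w≢w refl))) (sym (ind-yes (_≟_ X w w) refl)) ⟩
        ind (btw? X x w w) (μ w) +ᶻ ind (_≟_ X w w) (μ w)  ∎
      cases (no w≢z) = begin
        ind ((_≼?_ X x w) ×-dec (_≼?_ X w z)) (μ w)
          ≡⟨ ind-cong _ (btw? X x z w) (λ (a , b) → a , (b , w≢z)) (λ (a , (b , _)) → a , b) (λ _ → refl) ⟩
        ind (btw? X x z w) (μ w)
          ≡⟨ sym (ℤP.+-identityʳ _) ⟩
        ind (btw? X x z w) (μ w) +ᶻ 0ℤ
          ≡⟨ cong (ind (btw? X x z w) (μ w) +ᶻ_) (sym (ind-no (_≟_ X w z) w≢z)) ⟩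
        ind (btw? X x z w) (μ w) +ᶻ ind (_≟_ X w z) (μ w)  ∎

    end-term : Dec (x ≡ z) → ∑ (filter (btw? X x z) E) μ +ᶻ μ z ≡ δ x z
    end-term (yes refl) = begin
      ∑ (filter (btw? X x x) E) μ +ᶻ μ x  ≡⟨ cong₂ _+ᶻ_ (∑-zero (filter (btw? X x x) E) μ empty) (mobius-refl x) ⟩
      1ℤ                                  ≡⟨ sym (ind-yes (_≟_ X x x) refl) ⟩
      δ x x                               ∎
      where
      empty : ∀ w → w ∈ filter (btw? X x x) E → μ w ≡ 0ℤ
      empty w w∈ = let (_ , (xw , (wx , w≢x))) = ∈-filter⁻ (btw? X x x) {xs = E} w∈
                   in ⊥-elim (w≢x (⊑-antisym wx xw))
    end-term (no x≢z) = begin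
      below +ᶻ μ z        ≡⟨ cong (below +ᶻ_) (mobius-step x z xz x≢z) ⟩
      below +ᶻ - below    ≡⟨ ℤP.+-inverseʳ below ⟩
      0ℤ                  ≡⟨ sym (ind-no (_≟_ X x z) x≢z) ⟩
      δ x z               ∎
      where
      below : ℤ
      below = ∑ (filter (btw? X x z) E) μ

  mobius-total-sum : Unique E → ∀ x y → y ∈ E → x ⊑ y → ¬ x ≡ y →
    (∀ w → w ∈ E → x ⊑ w × w ⊑ y) → ∑ E (mobius X x) ≡ 0ℤ
  mobius-total-sum uE x y y∈ xy x≢y bounded = begin
    ∑ E (mobius X x)
      ≡⟨ ∑-cong E (λ w w∈ → sym (ind-yes ((_≼?_ X x w) ×-dec (_≼?_ X w y)) (bounded w w∈))) ⟩
    ∑ E (λ w → ind ((_≼?_ X x w) ×-dec (_≼?_ X w y)) (mobius X x w))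
      ≡⟨ mobius-interval-sum uE x y y∈ xy ⟩
    δ x y
      ≡⟨ ind-no (_≟_ X x y) x≢y ⟩
    0ℤ ∎

-- Partial-order structure of the constructions of Defs, and duality of μ.

dualFO : FinOrd → FinOrd
dualFO X = record { Carrier = Carrier X ; _≼_ = λ a b → _≼_ X b a ; _≼?_ = λ a b → _≼?_ X b a
                  ; _≟_ = _≟_ X ; elems = elems X }

po-dual : (X : FinOrd) → IsPartialOrder _≡_ (_≼_ X) → IsPartialOrder _≡_ (_≼_ (dualFO X))
po-dual X po = record
  { isPreorder = record { isEquivalence = isEquivalence
                        ; reflexive = λ { refl → IsPartialOrder.refl po }
                        ; trans = λ p q → IsPartialOrder.trans po q p }
  ; antisym = λ p q → IsPartialOrder.antisym po q p }

-- Both sides equal the double sum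
-- ∑_{x ≤ z ≤ w ≤ y} μ_X(x , z) μ_{X*}(y , w): summing over w first leaves
-- μ_X(x , z) δ(z , y), summing over z first leaves δ(x , w) μ_{X*}(y , w).
mobius-duality : (X : FinOrd) (po : IsPartialOrder _≡_ (_≼_ X)) → Unique (elems X) →
  ∀ x y → x ∈ elems X → y ∈ elems X → _≼_ X x y → mobius X x y ≡ mobius (dualFO X) y x
mobius-duality X po uE x y x∈ y∈ xy = trans (sym S≡μL) S≡μR
  where
  module A = Mobius X po
  module B = Mobius (dualFO X) (po-dual X po)
  E = elems X
  le = _≼?_ X
  μL = mobius X x
  μR = mobius (dualFO X) y

  in[_,_] : ∀ a c z → Dec (_≼_ X a z × _≼_ X z c)
  in[ a , c ] z = le a z ×-dec le z c

  S : ℤ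
  S = ∑ E (λ z → ind (in[ x , y ] z) (μL z *ᶻ ∑ E (λ w → ind (in[ z , y ] w) (μR w))))

  -- The inner sum over w is the dual interval sum of μ_{X*}(y , ·).
  inner-w : ∀ z → z ∈ E → _≼_ X z y → ∑ E (λ w → ind (in[ z , y ] w) (μR w)) ≡ B.δ y z
  inner-w z z∈ zy = trans (∑-cong E (λ w _ → ind-cong (in[ z , y ] w) (le w y ×-dec le z w)
                                           (λ (a , b) → b , a) (λ (a , b) → b , a) (λ _ → refl)))
                          (B.mobius-interval-sum uE y z z∈ zy)

  S≡μL : S ≡ μL y
  S≡μL = begin
    S
      ≡⟨ ∑-cong E (λ z z∈ → ind-cong (in[ x , y ] z) (in[ x , y ] z) (λ p → p) (λ p → p)
                              (λ (_ , zy) → cong (μL z *ᶻ_) (inner-w z z∈ zy))) ⟩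
    ∑ E (λ z → ind (in[ x , y ] z) (μL z *ᶻ B.δ y z))
      ≡⟨ ∑-single E _ y uE y∈ (λ z _ z≢y → trans (cong (ind (in[ x , y ] z))
              (trans (cong (μL z *ᶻ_) (ind-no (_≟_ X y z) (λ e → z≢y (sym e)))) (ℤP.*-zeroʳ (μL z))))
              (ind-0 (in[ x , y ] z))) ⟩
    ind (in[ x , y ] y) (μL y *ᶻ B.δ y y)
      ≡⟨ ind-yes (in[ x , y ] y) (xy , A.⊑-refl) ⟩
    μL y *ᶻ B.δ y y
      ≡⟨ cong (μL y *ᶻ_) (ind-yes (_≟_ X y y) refl) ⟩
    μL y *ᶻ 1ℤ
      ≡⟨ ℤP.*-identityʳ (μL y) ⟩
    μL y ∎

  -- For fixed w, the sum over z is the interval sum of μ_X(x , ·) up to w.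
  inner-z : ∀ w → w ∈ E →
    ∑ E (λ z → ind (in[ x , y ] z) (ind (in[ z , y ] w) (μL z *ᶻ μR w))) ≡ ind (in[ x , y ] w) (A.δ x w *ᶻ μR w)
  inner-z w w∈ = begin
    ∑ E (λ z → ind (in[ x , y ] z) (ind (in[ z , y ] w) (μL z *ᶻ μR w)))
      ≡⟨ ∑-cong E (λ z _ → regroup z) ⟩
    ∑ E (λ z → ind (in[ x , y ] w) (ind (in[ x , w ] z) (μL z) *ᶻ μR w))
      ≡⟨ sym (∑-ind (in[ x , y ] w) E _) ⟩
    ind (in[ x , y ] w) (∑ E (λ z → ind (in[ x , w ] z) (μL z) *ᶻ μR w))
      ≡⟨ cong (ind (in[ x , y ] w)) (sym (∑-*ʳ E (μR w) _)) ⟩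
    ind (in[ x , y ] w) (∑ E (λ z → ind (in[ x , w ] z) (μL z)) *ᶻ μR w)
      ≡⟨ ind-cong (in[ x , y ] w) (in[ x , y ] w) (λ p → p) (λ p → p)
                  (λ (xw , _) → cong (_*ᶻ μR w) (A.mobius-interval-sum uE x w w∈ xw)) ⟩
    ind (in[ x , y ] w) (A.δ x w *ᶻ μR w) ∎
    where
    -- x ≤ z ≤ y and z ≤ w ≤ y  ⇔  x ≤ w ≤ y and x ≤ z ≤ w.
    regroup : ∀ z → ind (in[ x , y ] z) (ind (in[ z , y ] w) (μL z *ᶻ μR w))
                  ≡ ind (in[ x , y ] w) (ind (in[ x , w ] z) (μL z) *ᶻ μR w)
    regroup z = begin
      ind (in[ x , y ] z) (ind (in[ z , y ] w) (μL z *ᶻ μR w))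
        ≡⟨ ind-and (in[ x , y ] z) (in[ z , y ] w) _ ⟩
      ind (in[ x , y ] z ×-dec in[ z , y ] w) (μL z *ᶻ μR w)
        ≡⟨ ind-cong (in[ x , y ] z ×-dec in[ z , y ] w) (in[ x , y ] w ×-dec in[ x , w ] z)
             (λ ((xz , _) , (zw , wy)) → (A.⊑-trans xz zw , wy) , (xz , zw))
             (λ ((_ , wy) , (xz , zw)) → (xz , A.⊑-trans zw wy) , (zw , wy)) (λ _ → refl) ⟩
      ind (in[ x , y ] w ×-dec in[ x , w ] z) (μL z *ᶻ μR w)
        ≡⟨ sym (ind-and (in[ x , y ] w) (in[ x , w ] z) _) ⟩
      ind (in[ x , y ] w) (ind (in[ x , w ] z) (μL z *ᶻ μR w))
        ≡⟨ cong (ind (in[ x , y ] w)) (sym (ind-*ʳ (in[ x , w ] z) (μR w) (μL z))) ⟩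
      ind (in[ x , y ] w) (ind (in[ x , w ] z) (μL z) *ᶻ μR w) ∎

  S≡μR : S ≡ μR x
  S≡μR = begin
    S
      ≡⟨ ∑-cong E (λ z _ → trans (cong (ind (in[ x , y ] z)) (trans (∑-*ˡ E (μL z) _)
                              (∑-cong E (λ w _ → ind-*ˡ (in[ z , y ] w) (μL z) (μR w)))))
                            (∑-ind (in[ x , y ] z) E _)) ⟩
    ∑ E (λ z → ∑ E (λ w → ind (in[ x , y ] z) (ind (in[ z , y ] w) (μL z *ᶻ μR w))))
      ≡⟨ ∑-swap E E _ ⟩
    ∑ E (λ w → ∑ E (λ z → ind (in[ x , y ] z) (ind (in[ z , y ] w) (μL z *ᶻ μR w))))
      ≡⟨ ∑-cong E inner-z ⟩
    ∑ E (λ w → ind (in[ x , y ] w) (A.δ x w *ᶻ μR w))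
      ≡⟨ ∑-single E _ x uE x∈ (λ w _ w≢x → trans (cong (ind (in[ x , y ] w))
              (trans (cong (_*ᶻ μR w) (ind-no (_≟_ X x w) (λ e → w≢x (sym e)))) (ℤP.*-zeroˡ (μR w))))
              (ind-0 (in[ x , y ] w))) ⟩
    ind (in[ x , y ] x) (A.δ x x *ᶻ μR x)
      ≡⟨ ind-yes (in[ x , y ] x) (A.⊑-refl , xy) ⟩
    A.δ x x *ᶻ μR x
      ≡⟨ cong (_*ᶻ μR x) (ind-yes (_≟_ X x x) refl) ⟩
    1ℤ *ᶻ μR x
      ≡⟨ ℤP.*-identityˡ (μR x) ⟩
    μR x ∎

-- The Rees order is transitive because its rank condition composes:
-- from q₂ + p₁ ≤ p₂ + q₁ and q₃ + p₂ ≤ p₃ + q₂ follows q₃ + p₁ ≤ p₃ + q₁.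
rank-condition-trans : ∀ q₂ p₁ p₂ q₁ q₃ p₃ →
  q₂ + p₁ ≤ p₂ + q₁ → q₃ + p₂ ≤ p₃ + q₂ → q₃ + p₁ ≤ p₃ + q₁
rank-condition-trans q₂ p₁ p₂ q₁ q₃ p₃ h h' = ℕP.+-cancelˡ-≤ (q₂ + p₂) _ _
  (subst₂ _≤_ (lhs q₂ p₁ p₂ q₃) (rhs q₂ p₂ q₁ p₃) (ℕP.+-mono-≤ h h'))
  where
  lhs : ∀ q₂ p₁ p₂ q₃ → (q₂ + p₁) + (q₃ + p₂) ≡ (q₂ + p₂) + (q₃ + p₁)
  lhs = solve-∀
  rhs : ∀ q₂ p₂ q₁ p₃ → (p₂ + q₁) + (p₃ + q₂) ≡ (q₂ + p₂) + (p₃ + q₁)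
  rhs = solve-∀

po-rees : (X Y : RFinOrd) → IsPartialOrder _≡_ (_≼_ (RFinOrd.ord X)) → IsPartialOrder _≡_ (_≼_ (RFinOrd.ord Y)) →
  IsPartialOrder _≡_ (_≼_ (rees X Y))
po-rees X Y poX poY = record
  { isPreorder = record
      { isEquivalence = isEquivalence
      ; reflexive = λ { {p , q} refl → IsPartialOrder.refl poX , IsPartialOrder.refl poY
                                       , ℕP.≤-reflexive (ℕP.+-comm (rY q) (rX p)) }
      ; trans = λ { {p₁ , q₁} {p₂ , q₂} {p₃ , q₃} (pp , qq , r) (pp' , qq' , r') →
            IsPartialOrder.trans poX pp pp' , IsPartialOrder.trans poY qq qq'
            , rank-condition-trans (rY q₂) (rX p₁) (rX p₂) (rY q₁) (rY q₃) (rX p₃) r r' } }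
  ; antisym = λ (pp , qq , _) (pp' , qq' , _) →
      cong₂ _,_ (IsPartialOrder.antisym poX pp pp') (IsPartialOrder.antisym poY qq qq') }
  where
  rX = RFinOrd.rk X
  rY = RFinOrd.rk Y

po-hat : (X : FinOrd) → IsPartialOrder _≡_ (_≼_ X) → IsPartialOrder _≡_ (_≼_ (hat X))
po-hat X po = record
  { isPreorder = record { isEquivalence = isEquivalence ; reflexive = λ { refl → hat-refl } ; trans = hat-trans }
  ; antisym = hat-antisym }
  where
  hat-refl : ∀ {z} → HatLe X z z
  hat-refl {hbot}  = bot≤
  hat-refl {htop}  = ≤top
  hat-refl {inn a} = inn≤ (IsPartialOrder.refl po)
  hat-trans : ∀ {x y z} → HatLe X x y → HatLe X y z → HatLe X x z
  hat-trans bot≤     _        = bot≤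
  hat-trans ≤top     ≤top     = ≤top
  hat-trans (inn≤ _) ≤top     = ≤top
  hat-trans (inn≤ p) (inn≤ q) = inn≤ (IsPartialOrder.trans po p q)
  hat-antisym : ∀ {x y} → HatLe X x y → HatLe X y x → x ≡ y
  hat-antisym bot≤     bot≤     = refl
  hat-antisym ≤top     ≤top     = refl
  hat-antisym (inn≤ p) (inn≤ q) = cong inn (IsPartialOrder.antisym po p q)

unique-rees : (X Y : RFinOrd) → Unique (elems (RFinOrd.ord X)) → Unique (elems (RFinOrd.ord Y)) →
  Unique (elems (rees X Y))
unique-rees X Y uX uY = Unique.filter⁺ _ (Unique.cartesianProduct⁺ uX uY)

unique-sub : (X : FinOrd) {R : Carrier X → Set} (r : ∀ x → Dec (R x)) → Unique (elems X) → Unique (elems (sub X r))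
unique-sub X r = Unique.filter⁺ r

unique-hat : (X : FinOrd) → Unique (elems X) → Unique (elems (hat X))
unique-hat X uX = All.tabulate hbot-new ∷ All.tabulate htop-new ∷ Unique.map⁺ inn-injective uX
  where
  inn-injective : ∀ {a b} → inn {Carrier X} a ≡ inn b → a ≡ b
  inn-injective refl = refl
  hbot-new : ∀ {y} → y ∈ htop ∷ map inn (elems X) → ¬ hbot ≡ y
  hbot-new (here refl) ()
  hbot-new (there m) e with ∈-map⁻ inn m
  ... | _ , _ , refl with e
  ...   | ()
  htop-new : ∀ {y} → y ∈ map inn (elems X) → ¬ htop ≡ y
  htop-new m e with ∈-map⁻ inn m
  ... | _ , _ , refl with e
  ...   | ()

module Ranked (P : BoundedRankedPoset) where
  open BoundedRankedPoset P
  open Mobius ord isPO using (⊏-trans)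
  private
    C = Carrier ord
    _⊏_ = _≺_ ord

  strictly-between? : (x y : C) → ∀ w → Dec (x ⊏ w × w ⊏ y)
  strictly-between? x y w = (_≺?_ ord x w) ×-dec (_≺?_ ord w y)

  -- By induction on the size of the open interval (x , y): if it is empty,
  -- y covers x; otherwise split at an element w of it.
  rank-strict : ∀ x y → x ⊏ y → rank x < rank y
  rank-strict x y = by-size (suc (open-size x y)) x y ℕP.≤-refl
    where
    open-size : C → C → ℕ
    open-size x y = length (filter (strictly-between? x y) (elems ord))

    by-size : ∀ k x y → open-size x y < k → x ⊏ y → rank x < rank y
    by-size (suc k) x y lt xy = split (filter (strictly-between? x y) (elems ord)) refl
      where
      split : ∀ l → filter (strictly-between? x y) (elems ord) ≡ l → rank x < rank y
      split [] empty = ℕP.≤-reflexive (sym (rank-cov x y (xy , no-middle)))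
        where
        no-middle : ∀ z → x ⊏ z → z ⊏ y → ⊥
        no-middle z xz zy with subst (z ∈_) empty (∈-filter⁺ (strictly-between? x y) (complete z) (xz , zy))
        ... | ()
      split (w ∷ _) eq =
        let (_ , (xw , wy)) = ∈-filter⁻ (strictly-between? x y) {xs = elems ord} (subst (w ∈_) (sym eq) (here refl))
            smaller-left = length-filter-mono-< (strictly-between? x w) (strictly-between? x y) (elems ord)
                             (λ z _ (xz , zw) → xz , ⊏-trans zw wy) w (complete w) (xw , wy) (λ (_ , (_ , w≢w)) → w≢w refl)
            smaller-right = length-filter-mono-< (strictly-between? w y) (strictly-between? x y) (elems ord)
                             (λ z _ (wz , zy) → ⊏-trans xw wz , zy) w (complete w) (xw , wy) (λ ((_ , w≢w) , _) → w≢w refl)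
        in ℕP.<-trans (by-size k x w (ℕP.<-≤-trans smaller-left (ℕP.≤-pred lt)) xw)
                      (by-size k w y (ℕP.<-≤-trans smaller-right (ℕP.≤-pred lt)) wy)

  rank-mono : ∀ x y → _≼_ ord x y → rank x ≤ rank y
  rank-mono x y xy with _≟_ ord x y
  ... | yes refl = ℕP.≤-refl
  ... | no x≢y   = ℕP.<⇒≤ (rank-strict x y (xy , x≢y))

  rank≤len : ∀ a → rank a ≤ len
  rank≤len a = rank-mono a top (top-max a)

  rank-pos : ∀ a → ¬ a ≡ bot → 1 ≤ rank a
  rank-pos a a≢bot = subst (λ r → suc r ≤ rank a) rank-bot (rank-strict bot a (bot-min a , λ e → a≢bot (sym e)))

  rank-pos⁻¹ : ∀ a → 1 ≤ rank a → ¬ a ≡ bot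
  rank-pos⁻¹ a 1≤ra refl with rank bot | rank-bot
  rank-pos⁻¹ a () refl | .0 | refl

-- With
-- n the length of P, a rank-ρ element of P has rank n ∸ ρ in P*, and rank
-- ρ ∸ 1 in P⁻; the lemmas below translate the Rees conditions of R_i(P*)
-- into those of I_{i-1}(P) along the reflection.

<⇒≤∸1 : ∀ {j i} → j < i → j ≤ i ∸ 1
<⇒≤∸1 (s≤s j≤i) = j≤i

≤∸1⇒< : ∀ {j i} → 1 ≤ i → j ≤ i ∸ 1 → j < i
≤∸1⇒< {i = suc i} _ j≤i = s≤s j≤i

reflect-involutive : ∀ i j → j < i → i ∸ suc (i ∸ suc j) ≡ j
reflect-involutive (suc i) j (s≤s j≤i) = ℕP.m∸[m∸n]≡n j≤i

reflect-< : ∀ i j → j < i → i ∸ suc j < i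
reflect-< (suc i) j (s≤s _) = s≤s (ℕP.m∸n≤m i j)

reflect-zero : ∀ i j → j < i → i ∸ suc j ≡ 0 ⇔ j ≡ i ∸ 1
reflect-zero (suc i) j (s≤s j≤i) = mk⇔ (λ e → ℕP.≤-antisym j≤i (ℕP.m∸n≡0⇒m≤n e)) (λ { refl → ℕP.n∸n≡0 j })

≤-balanced : ∀ {x y x' y'} → x + y' ≡ x' + y → x ≤ y ⇔ x' ≤ y'
≤-balanced e = mk⇔ (move e) (move (sym e))
  where
  move : ∀ {x y x' y'} → x + y' ≡ x' + y → x ≤ y → x' ≤ y'
  move {x} {y} {x'} {y'} e x≤y = ℕP.+-cancelʳ-≤ y x' y' (subst₂ _≤_ e (ℕP.+-comm y y') (ℕP.+-monoˡ-≤ y' x≤y))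

-- Membership: for j < i and ρ ≤ n, with k = i ∸ suc j,
--   k ≤ n ∸ ρ  and  i + (n ∸ ρ) ≤ n + k      ((a , k) ∈ R_i(P*))
-- iff
--   1 ≤ ρ,  j ≤ ρ ∸ 1  and  (i ∸ 1) + (ρ ∸ 1) ≤ (n ∸ 1) + j   ((a , j) ∈ I_{i-1}(P)).
reflect-membership : ∀ n i ρ j → j < i → ρ ≤ n →
  ((i ∸ suc j ≤ n ∸ ρ) × (i + (n ∸ ρ) ≤ n + (i ∸ suc j)))
  ⇔ ((1 ≤ ρ) × (j ≤ ρ ∸ 1) × ((i ∸ 1) + (ρ ∸ 1) ≤ (n ∸ 1) + j))
reflect-membership n (suc i) zero j (s≤s j≤i) _ = mk⇔ (λ (_ , p) → ⊥-elim (too-big p)) (λ ())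
  where
  too-big : ¬ (suc i + (n ∸ 0) ≤ n + (i ∸ j))
  too-big p = ℕP.<-irrefl refl (subst (suc (i + n) ≤_) (ℕP.+-comm n i)
                (ℕP.≤-trans p (ℕP.+-monoʳ-≤ n (ℕP.m∸n≤m i j))))
reflect-membership (suc n) (suc i) (suc ρ) j (s≤s j≤i) (s≤s ρ≤n) =
  mk⇔ (λ { (k≤s , s≤s is≤nk) → s≤s z≤n , Equivalence.from ρ-side is≤nk , Equivalence.to k-side k≤s })
      (λ (_ , j≤ρ , iρ≤nj) → Equivalence.from k-side iρ≤nj , s≤s (Equivalence.to ρ-side j≤ρ))
  where
  k = i ∸ j
  s = n ∸ ρ
  k-side : k ≤ s ⇔ i + ρ ≤ n + j
  k-side = ≤-balanced (subst₂ (λ i n → k + (n + j) ≡ (i + ρ) + s) (ℕP.m∸n+n≡m j≤i) (ℕP.m∸n+n≡m ρ≤n) (e k j s ρ))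
    where
    e : ∀ k j s ρ → k + ((s + ρ) + j) ≡ ((k + j) + ρ) + s
    e = solve-∀
  ρ-side : j ≤ ρ ⇔ i + s ≤ n + k
  ρ-side = ≤-balanced (subst₂ (λ i n → j + (n + k) ≡ (i + s) + ρ) (ℕP.m∸n+n≡m j≤i) (ℕP.m∸n+n≡m ρ≤n) (e k j s ρ))
    where
    e : ∀ k j s ρ → j + ((s + ρ) + k) ≡ ((k + j) + s) + ρ
    e = solve-∀

-- Order: for j , j' < i and 1 ≤ ρ , ρ' ≤ n, with k = i ∸ suc j, k' = i ∸ suc j',
--   j' ≤ j  and  j + (n ∸ ρ') ≤ (n ∸ ρ) + j'     ((a' , j') ≤ (a , j) in R(P*))
-- iff
--   k ≤ k'  and  k' + (ρ ∸ 1) ≤ (ρ' ∸ 1) + k     ((a , k) ≤ (a' , k') in P⁻ ∗ C_n).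
reflect-order : ∀ n i ρ ρ' j j' → j < i → j' < i → 1 ≤ ρ → 1 ≤ ρ' → ρ ≤ n → ρ' ≤ n →
  ((j' ≤ j) × (j + (n ∸ ρ') ≤ (n ∸ ρ) + j'))
  ⇔ ((i ∸ suc j ≤ i ∸ suc j') × ((i ∸ suc j') + (ρ ∸ 1) ≤ (ρ' ∸ 1) + (i ∸ suc j)))
reflect-order (suc n) (suc i) (suc ρ) (suc ρ') j j' (s≤s j≤i) (s≤s j'≤i) _ _ (s≤s ρ≤n) (s≤s ρ'≤n) =
  mk⇔ (λ (a , b) → Equivalence.to index-side a , Equivalence.to rank-side b)
      (λ (a , b) → Equivalence.from index-side a , Equivalence.from rank-side b)
  where
  k = i ∸ j
  k' = i ∸ j'
  s = n ∸ ρ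
  s' = n ∸ ρ'
  index-side : j' ≤ j ⇔ k ≤ k'
  index-side = ≤-balanced (trans (ℕP.+-comm j' k') (trans (ℕP.m∸n+n≡m j'≤i) (sym (ℕP.m∸n+n≡m j≤i))))
  rank-side : j + s' ≤ s + j' ⇔ k' + ρ ≤ ρ' + k
  rank-side = ≤-balanced (trans (e₁ j s' ρ' k) (trans (cong₂ _+_ (ℕP.m∸n+n≡m ρ'≤n) (ℕP.m∸n+n≡m j≤i))
                         (sym (trans (e₂ k' ρ s j') (cong₂ _+_ (ℕP.m∸n+n≡m ρ≤n) (ℕP.m∸n+n≡m j'≤i))))))
    where
    e₁ : ∀ j s' ρ' k → (j + s') + (ρ' + k) ≡ (s' + ρ') + (k + j)
    e₁ = solve-∀
    e₂ : ∀ k' ρ s j' → (k' + ρ) + (s + j') ≡ (s + ρ) + (k' + j')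
    e₂ = solve-∀

-- Below level i, the condition i + (n ∸ ρ) ≤ n + j for lying under (0̂_P , x_i)
-- in R(P*) forces the rank ρ to be positive.
rank-forced : ∀ n i j ρ → j < i → i + (n ∸ ρ) ≤ n + j → 1 ≤ ρ
rank-forced n i j zero    j<i p = ⊥-elim (ℕP.<-irrefl refl (ℕP.≤-trans (ℕP.+-monoˡ-≤ n j<i)
                                    (subst (i + n ≤_) (ℕP.+-comm n j) p)))
rank-forced n i j (suc ρ) _   _ = s≤s z≤n

∑-hat : (X : FinOrd) (g : Hat (Carrier X) → ℤ) →
  ∑ (elems (hat X)) g ≡ g hbot +ᶻ (g htop +ᶻ ∑ (elems X) (λ w → g (inn w)))
∑-hat X g = cong (λ s → g hbot +ᶻ (g htop +ᶻ s)) (∑-map (elems X) inn g)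

∑-sub-rees : (X : RFinOrd) (m : ℕ) {S : Carrier (RFinOrd.ord X) × ℕ → Set}
  (s : ∀ z → Dec (S z)) (g : Carrier (RFinOrd.ord X) × ℕ → ℤ) →
  ∑ (elems (sub (rees X (chainR m)) s)) g
    ≡ ∑ (elems (RFinOrd.ord X)) (λ a → ∑< m (λ j → ind (j ≤? RFinOrd.rk X a) (ind (s (a , j)) (g (a , j)))))
∑-sub-rees X m s g = begin
  ∑ (filter s (filter level? pairs)) g
    ≡⟨ ∑-filter s (filter level? pairs) g ⟩
  ∑ (filter level? pairs) (λ z → ind (s z) (g z))
    ≡⟨ ∑-filter level? pairs _ ⟩
  ∑ pairs (λ z → ind (level? z) (ind (s z) (g z)))
    ≡⟨ ∑-cartesianProduct (elems (RFinOrd.ord X)) (upTo m) _ ⟩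
  ∑ (elems (RFinOrd.ord X)) (λ a → ∑ (upTo m) (λ j → ind (level? (a , j)) (ind (s (a , j)) (g (a , j)))))
    ≡⟨ ∑-cong (elems (RFinOrd.ord X)) (λ a _ → ∑-upTo m _) ⟩
  ∑ (elems (RFinOrd.ord X)) (λ a → ∑< m (λ j → ind (j ≤? RFinOrd.rk X a) (ind (s (a , j)) (g (a , j))))) ∎
  where
  level? : ∀ (z : Carrier (RFinOrd.ord X) × ℕ) → Dec (proj₂ z ≤ RFinOrd.rk X (proj₁ z))
  level? z = proj₂ z ≤? RFinOrd.rk X (proj₁ z)
  pairs = cartesianProduct (elems (RFinOrd.ord X)) (upTo m)

module Setting (P : BoundedRankedPoset) (i : ℕ) (1≤i : 1 ≤ i) (i≤n : i ≤ BoundedRankedPoset.len P) where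
  open BoundedRankedPoset P
  open Ranked P using (rank≤len; rank-pos; rank-pos⁻¹)

  private
    C = Carrier ord
    n = len

  Q : FinOrd
  Q = Riposet (dualR P) i

  b t : C × ℕ
  b = top , 0
  t = bot , i

  I : FinOrd
  I = Iposet (toR P) (i ∸ 1)

  -- The dual of Î, whose minimum is the new top element htop.
  H* : FinOrd
  H* = dualFO (hat I)

  μQ : C × ℕ → ℤ
  μQ = mobius Q b

  μ* : Hat (C × ℕ) → ℤ
  μ* = mobius H* htop

  po-Q : IsPartialOrder _≡_ (_≼_ Q)
  po-Q = po-rees (dualR P) (chainR (suc (n ∸ rank bot))) (po-dual ord isPO) ℕP.≤-isPartialOrder

  po-I : IsPartialOrder _≡_ (_≼_ I)
  po-I = po-rees (minusR (toR P)) (chainR n) isPO ℕP.≤-isPartialOrder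

  unique-Q : Unique (elems Q)
  unique-Q = unique-sub (Rposet (dualR P)) _ (unique-rees (dualR P) (chainR (suc (n ∸ rank bot))) unique (Unique.upTo⁺ _))

  unique-I : Unique (elems I)
  unique-I = unique-sub (rees (minusR (toR P)) (chainR n)) _
                (unique-rees (minusR (toR P)) (chainR n) (Unique.filter⁺ _ unique) (Unique.upTo⁺ n))

  module MQ = Mobius Q po-Q
  module MH* = Mobius H* (po-dual (hat I) (po-hat I po-I))

  n∸rank-bot : n ∸ rank bot ≡ n
  n∸rank-bot = cong (n ∸_) rank-bot

  Q-member⁻ : ∀ {z} → z ∈ elems Q → (proj₂ z ≤ n ∸ rank (proj₁ z)) × _≼_ Q z t
  Q-member⁻ z∈ = let (z∈' , z≤t) = ∈-filter⁻ _ {xs = elems (Rposet (dualR P))} z∈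
                 in proj₂ (∈-filter⁻ _ {xs = cartesianProduct (elems ord) (upTo _)} z∈') , z≤t

  Q-member⁺ : ∀ a j → j ≤ n ∸ rank a → _≼_ Q (a , j) t → (a , j) ∈ elems Q
  Q-member⁺ a j j≤ z≤t = ∈-filter⁺ _ (∈-filter⁺ _ (∈-cartesianProduct⁺ (complete a) (∈-upTo⁺ j<)) j≤) z≤t
    where
    j< : j < suc (n ∸ rank bot)
    j< = s≤s (subst (j ≤_) (sym n∸rank-bot) (ℕP.≤-trans j≤ (ℕP.m∸n≤m n (rank a))))

  b-least : ∀ z → z ∈ elems Q → _≼_ Q b z
  b-least (a , j) z∈ = top-max a , z≤n ,
    subst₂ _≤_ (sym (trans (cong (j +_) (ℕP.n∸n≡0 n)) (ℕP.+-identityʳ j))) (sym (ℕP.+-identityʳ _)) (proj₁ (Q-member⁻ z∈))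

  t-greatest : ∀ z → z ∈ elems Q → _≼_ Q z t
  t-greatest z z∈ = proj₂ (Q-member⁻ z∈)

  b∈Q : b ∈ elems Q
  b∈Q = Q-member⁺ top 0 z≤n (bot-min top , z≤n , i+0≤n+0)
    where
    i+0≤n+0 : i + (n ∸ n) ≤ (n ∸ rank bot) + 0
    i+0≤n+0 = subst₂ _≤_ (sym (trans (cong (i +_) (ℕP.n∸n≡0 n)) (ℕP.+-identityʳ i)))
                         (sym (trans (ℕP.+-identityʳ _) n∸rank-bot)) i≤n

  t∈Q : t ∈ elems Q
  t∈Q = Q-member⁺ bot i (subst (i ≤_) (sym n∸rank-bot) i≤n) MQ.⊑-refl

  b≢t : ¬ b ≡ t
  b≢t b≡t = ℕP.<-irrefl (cong proj₂ b≡t) 1≤i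

  Q-rank-pos : ∀ a j → (a , j) ∈ elems Q → j < i → 1 ≤ rank a
  Q-rank-pos a j z∈ j<i = rank-forced n i j (rank a) j<i
    (subst (λ m → i + (n ∸ rank a) ≤ m + j) n∸rank-bot (proj₂ (proj₂ (proj₂ (Q-member⁻ z∈)))))

  Q-sum-zero : ∑ (elems Q) μQ ≡ 0ℤ
  Q-sum-zero = MQ.mobius-total-sum unique-Q b t t∈Q (b-least t t∈Q) b≢t (λ w w∈ → b-least w w∈ , t-greatest w w∈)

  -- Q' = { (a , j) ∈ Q : j < i , (a , j) ≠ b }, the part of Q reflected onto I.
  Q'? : ∀ z → Dec (proj₂ z < i × ¬ z ≡ b)
  Q'? z = (proj₂ z <? i) ×-dec ¬? (_≟_ Q z b)

  -- The right-hand side of the corollary, as a sum over the top level j = i.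
  R : ℤ
  R = ∑ (elems Q) (λ z → ind (proj₂ z ≟ℕ i) (μQ z))

  Q-trichotomy : ∀ z → proj₂ z ≤ i → (u : ℤ) →
    ind (_≟_ Q z b) u +ᶻ (ind (Q'? z) u +ᶻ ind (proj₂ z ≟ℕ i) u) ≡ u
  Q-trichotomy z j≤i u = cases z j≤i (_≟_ Q z b) (proj₂ z ≟ℕ i)
    where
    cases : ∀ z → proj₂ z ≤ i → Dec (z ≡ b) → Dec (proj₂ z ≡ i) →
      ind (_≟_ Q z b) u +ᶻ (ind (Q'? z) u +ᶻ ind (proj₂ z ≟ℕ i) u) ≡ u
    cases z _ (yes refl) _ = begin
      ind (_≟_ Q b b) u +ᶻ (ind (Q'? b) u +ᶻ ind (0 ≟ℕ i) u)
        ≡⟨ cong₂ _+ᶻ_ (ind-yes (_≟_ Q b b) refl)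
                      (cong₂ _+ᶻ_ (ind-no (Q'? b) (λ (_ , b≢b) → b≢b refl))
                                  (ind-no (0 ≟ℕ i) (λ 0≡i → ℕP.<-irrefl 0≡i 1≤i))) ⟩
      u +ᶻ 0ℤ
        ≡⟨ ℤP.+-identityʳ u ⟩
      u ∎
    cases z _ (no z≢b) (yes j≡i) = begin
      ind (_≟_ Q z b) u +ᶻ (ind (Q'? z) u +ᶻ ind (proj₂ z ≟ℕ i) u)
        ≡⟨ cong₂ _+ᶻ_ (ind-no (_≟_ Q z b) z≢b)
                      (cong₂ _+ᶻ_ (ind-no (Q'? z) (λ (j<i , _) → ℕP.<-irrefl j≡i j<i)) (ind-yes (proj₂ z ≟ℕ i) j≡i)) ⟩
      0ℤ +ᶻ (0ℤ +ᶻ u)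
        ≡⟨ trans (ℤP.+-identityˡ _) (ℤP.+-identityˡ u) ⟩
      u ∎
    cases z j≤i (no z≢b) (no j≢i) = begin
      ind (_≟_ Q z b) u +ᶻ (ind (Q'? z) u +ᶻ ind (proj₂ z ≟ℕ i) u)
        ≡⟨ cong₂ _+ᶻ_ (ind-no (_≟_ Q z b) z≢b)
                      (cong₂ _+ᶻ_ (ind-yes (Q'? z) (ℕP.≤∧≢⇒< j≤i j≢i , z≢b)) (ind-no (proj₂ z ≟ℕ i) j≢i)) ⟩
      0ℤ +ᶻ (u +ᶻ 0ℤ)
        ≡⟨ trans (ℤP.+-identityˡ _) (ℤP.+-identityʳ u) ⟩
      u ∎

  Q-sum-split : ∑ (elems Q) μQ ≡ 1ℤ +ᶻ (∑ (elems Q) (λ z → ind (Q'? z) (μQ z)) +ᶻ R)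
  Q-sum-split = begin
    ∑ (elems Q) μQ
      ≡⟨ ∑-cong (elems Q) (λ z z∈ → sym (Q-trichotomy z (proj₁ (proj₂ (t-greatest z z∈))) (μQ z))) ⟩
    ∑ (elems Q) (λ z → at-b z +ᶻ (in-Q' z +ᶻ on-top z))
      ≡⟨ trans (∑-+ (elems Q) at-b _) (cong (∑ (elems Q) at-b +ᶻ_) (∑-+ (elems Q) in-Q' on-top)) ⟩
    ∑ (elems Q) at-b +ᶻ (∑ (elems Q) in-Q' +ᶻ R)
      ≡⟨ cong (_+ᶻ (∑ (elems Q) in-Q' +ᶻ R)) (trans (∑-at (_≟_ Q) (elems Q) μQ b unique-Q b∈Q) (MQ.mobius-refl b)) ⟩
    1ℤ +ᶻ (∑ (elems Q) in-Q' +ᶻ R) ∎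
    where
    at-b in-Q' on-top : C × ℕ → ℤ
    at-b z   = ind (_≟_ Q z b) (μQ z)
    in-Q' z  = ind (Q'? z) (μQ z)
    on-top z = ind (proj₂ z ≟ℕ i) (μQ z)

  φ : C × ℕ → C × ℕ
  φ (a , j) = a , i ∸ suc j

  φ-injective : ∀ z z' → proj₂ z < i → proj₂ z' < i → φ z ≡ φ z' → z ≡ z'
  φ-injective (a , j) (a' , j') j<i j'<i e = cong₂ _,_ (cong proj₁ e) (begin
    j                      ≡⟨ sym (reflect-involutive i j j<i) ⟩
    i ∸ suc (i ∸ suc j)    ≡⟨ cong (λ k → i ∸ suc k) (cong proj₂ e) ⟩
    i ∸ suc (i ∸ suc j')   ≡⟨ reflect-involutive i j' j'<i ⟩
    j'                     ∎)

  φ-antitone : ∀ y z → y ∈ elems Q → z ∈ elems Q → proj₂ y < i → proj₂ z < i →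
    _≼_ Q z y ⇔ _≼_ I (φ y) (φ z)
  φ-antitone (a , j) (a' , j') y∈ z∈ j<i j'<i =
    mk⇔ (λ (a≤a' , levels) → a≤a' , Equivalence.to order levels)
        (λ (a≤a' , levels) → a≤a' , Equivalence.from order levels)
    where
    order = reflect-order n i (rank a) (rank a') j j' j<i j'<i
              (Q-rank-pos a j y∈ j<i) (Q-rank-pos a' j' z∈ j'<i) (rank≤len a) (rank≤len a')

  reflect-sum : (h : C × ℕ → ℤ) → ∑ (elems Q) (λ z → ind (Q'? z) (h (φ z))) ≡ ∑ (elems I) h
  reflect-sum h = begin
    ∑ (elems Q) g
      ≡⟨ ∑-sub-rees (dualR P) m below-t? g ⟩
    ∑ (elems ord) (λ a → ∑< m (FQ a))
      ≡⟨ ∑-cong (elems ord) (λ a _ → per-element a) ⟩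
    ∑ (elems ord) (λ a → ind (not-bot? a) (∑< n (FI a)))
      ≡⟨ sym (∑-filter not-bot? (elems ord) _) ⟩
    ∑ (filter not-bot? (elems ord)) (λ a → ∑< n (FI a))
      ≡⟨ sym (∑-sub-rees (minusR (toR P)) n below-top? h) ⟩
    ∑ (elems I) h ∎
    where
    m = suc (n ∸ rank bot)
    g : C × ℕ → ℤ
    g z = ind (Q'? z) (h (φ z))
    below-t? : ∀ z → Dec (_≼_ Q z t)
    below-t? z = _≼?_ Q z t
    below-top? : ∀ z → Dec (_≺_ I z (top , i ∸ 1))
    below-top? z = _≺?_ I z (top , i ∸ 1)
    not-bot? : ∀ a → Dec (¬ a ≡ bot)
    not-bot? a = ¬? (_≟_ ord a bot)
    FQ FI : C → ℕ → ℤ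
    FQ a j = ind (j ≤? n ∸ rank a) (ind (below-t? (a , j)) (g (a , j)))
    FI a j = ind (j ≤? rank a ∸ 1) (ind (below-top? (a , j)) (h (a , j)))

    FQ-vanishes : ∀ a j → i ≤ j → FQ a j ≡ 0ℤ
    FQ-vanishes a j i≤j = begin
      FQ a j  ≡⟨ cong (λ u → ind (j ≤? n ∸ rank a) (ind (below-t? (a , j)) u))
                      (ind-no (Q'? (a , j)) (λ (j<i , _) → ℕP.≤⇒≯ i≤j j<i)) ⟩
      ind (j ≤? n ∸ rank a) (ind (below-t? (a , j)) 0ℤ)  ≡⟨ cong (ind (j ≤? n ∸ rank a)) (ind-0 (below-t? (a , j))) ⟩
      ind (j ≤? n ∸ rank a) 0ℤ                            ≡⟨ ind-0 (j ≤? n ∸ rank a) ⟩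
      0ℤ ∎

    FI-vanishes : ∀ a j → i ≤ j → FI a j ≡ 0ℤ
    FI-vanishes a j i≤j = trans (cong (ind (j ≤? rank a ∸ 1))
        (ind-no (below-top? (a , j)) (λ ((_ , j≤ , _) , _) → ℕP.≤⇒≯ i≤j (≤∸1⇒< 1≤i j≤))))
      (ind-0 (j ≤? rank a ∸ 1))

    -- The level k = i-1-j of (a , k) ∈ Q' corresponds to the level j of (a , j) ∈ I.
    reflected-term : ∀ a j → j < i → FQ a (i ∸ suc j) ≡ ind (not-bot? a) (FI a j)
    reflected-term a j j<i = begin
      FQ a k
        ≡⟨ trans (cong (ind (k ≤? n ∸ ρ)) (ind-and (below-t? (a , k)) (Q'? (a , k)) _))
                 (ind-and (k ≤? n ∸ ρ) (below-t? (a , k) ×-dec Q'? (a , k)) _) ⟩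
      ind ((k ≤? n ∸ ρ) ×-dec (below-t? (a , k) ×-dec Q'? (a , k))) (h (φ (a , k)))
        ≡⟨ ind-cong _ (not-bot? a ×-dec ((j ≤? ρ ∸ 1) ×-dec below-top? (a , j))) to from
                    (λ _ → cong (λ l → h (a , l)) (reflect-involutive i j j<i)) ⟩
      ind (not-bot? a ×-dec ((j ≤? ρ ∸ 1) ×-dec below-top? (a , j))) (h (a , j))
        ≡⟨ sym (trans (cong (ind (not-bot? a)) (ind-and (j ≤? ρ ∸ 1) (below-top? (a , j)) _))
                      (ind-and (not-bot? a) ((j ≤? ρ ∸ 1) ×-dec below-top? (a , j)) _)) ⟩
      ind (not-bot? a) (FI a j) ∎
      where
      k = i ∸ suc j
      ρ = rank a
      levels = reflect-membership n i ρ j j<i (rank≤len a)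
      k≡0⇔ = reflect-zero i j j<i
      Q-side I-side : Set
      Q-side = (k ≤ n ∸ ρ) × (_≼_ Q (a , k) t × (k < i × ¬ (a , k) ≡ b))
      I-side = (¬ a ≡ bot) × ((j ≤ ρ ∸ 1) × _≺_ I (a , j) (top , i ∸ 1))
      to : Q-side → I-side
      to (k≤ , (_ , _ , ineq) , (_ , k≢b)) =
        let (1≤ρ , j≤ , ineqI) = Equivalence.to levels (k≤ , subst (λ u → i + (n ∸ ρ) ≤ u + k) n∸rank-bot ineq)
        in rank-pos⁻¹ a 1≤ρ , j≤ , ((top-max a , <⇒≤∸1 j<i , ineqI) ,
             λ e → k≢b (cong₂ _,_ (cong proj₁ e) (Equivalence.from k≡0⇔ (cong proj₂ e))))
      from : I-side → Q-side
      from (a≢bot , j≤ , ((_ , _ , ineqI) , j≢top)) =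
        let (k≤ , ineq) = Equivalence.from levels (rank-pos a a≢bot , j≤ , ineqI)
        in k≤ , (bot-min a , ℕP.m∸n≤m i (suc j) , subst (λ u → i + (n ∸ ρ) ≤ u + k) (sym n∸rank-bot) ineq) ,
           (reflect-< i j j<i , λ e → j≢top (cong₂ _,_ (cong proj₁ e) (Equivalence.to k≡0⇔ (cong proj₂ e))))

    per-element : ∀ a → ∑< m (FQ a) ≡ ind (not-bot? a) (∑< n (FI a))
    per-element a = begin
      ∑< m (FQ a)                                    ≡⟨ ∑<-truncate i m (FQ a) i≤m (FQ-vanishes a) ⟩
      ∑< i (FQ a)                                    ≡⟨ sym (∑<-reverse i (FQ a)) ⟩
      ∑< i (λ j → FQ a (i ∸ suc j))                  ≡⟨ ∑<-cong i (reflected-term a) ⟩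
      ∑< i (λ j → ind (not-bot? a) (FI a j))         ≡⟨ sym (∑<-ind (not-bot? a) i (FI a)) ⟩
      ind (not-bot? a) (∑< i (FI a))                 ≡⟨ cong (ind (not-bot? a)) (sym (∑<-truncate i n (FI a) i≤n (FI-vanishes a))) ⟩
      ind (not-bot? a) (∑< n (FI a))                 ∎
      where
      i≤m : i ≤ m
      i≤m = subst (λ l → i ≤ suc l) (sym n∸rank-bot) (ℕP.m≤n⇒m≤1+n i≤n)

  ψ-cases : ∀ z → Dec (z ≡ b) → Hat (C × ℕ)
  ψ-cases z (yes _) = htop
  ψ-cases z (no _)  = inn (φ z)

  ψ : C × ℕ → Hat (C × ℕ)
  ψ z = ψ-cases z (_≟_ Q z b)

  ψ-b : ψ b ≡ htop
  ψ-b with _≟_ Q b b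
  ... | yes _   = refl
  ... | no b≢b  = ⊥-elim (b≢b refl)

  ψ-Q' : ∀ z → ¬ z ≡ b → ψ z ≡ inn (φ z)
  ψ-Q' z z≢b with _≟_ Q z b
  ... | yes z≡b = ⊥-elim (z≢b z≡b)
  ... | no _    = refl

  inn-injective : ∀ {w w'} → inn {C × ℕ} w ≡ inn w' → w ≡ w'
  inn-injective refl = refl

  -- The half-open interval [b , y) of Q is carried by ψ onto the interval
  -- [htop , inn (φ y)) of H*: termwise comparison of the two indicator sums.
  interval-match : ∀ y → y ∈ elems Q → proj₂ y < i → _≼_ Q b y → ¬ b ≡ y →
    ∀ z → z ∈ elems Q →
    ind (btw? Q b y z) (μ* (ψ z))
      ≡ ind (_≟_ Q z b) (μ* (ψ z)) +ᶻ ind (Q'? z) (ind (btw? H* htop (inn (φ y)) (inn (φ z))) (μ* (inn (φ z))))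
  interval-match y y∈ j<i b≤y b≢y z z∈ = cases z z∈ (_≟_ Q z b)
    where
    cases : ∀ z → z ∈ elems Q → Dec (z ≡ b) →
      ind (btw? Q b y z) (μ* (ψ z))
        ≡ ind (_≟_ Q z b) (μ* (ψ z)) +ᶻ ind (Q'? z) (ind (btw? H* htop (inn (φ y)) (inn (φ z))) (μ* (inn (φ z))))
    cases z _ (yes refl) = begin
      ind (btw? Q b y b) (μ* (ψ b))                    ≡⟨ ind-yes (btw? Q b y b) (MQ.⊑-refl , (b≤y , b≢y)) ⟩
      μ* (ψ b)                                         ≡⟨ sym (ℤP.+-identityʳ _) ⟩
      μ* (ψ b) +ᶻ 0ℤ                                   ≡⟨ cong₂ _+ᶻ_ (sym (ind-yes (_≟_ Q b b) refl))
                                                                     (sym (ind-no (Q'? b) (λ (_ , b≢b) → b≢b refl))) ⟩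
      ind (_≟_ Q b b) (μ* (ψ b)) +ᶻ ind (Q'? b) _      ∎
    cases z z∈ (no z≢b) = begin
      ind (btw? Q b y z) (μ* (ψ z))
        ≡⟨ ind-cong (btw? Q b y z) (Q'? z ×-dec btw? H* htop (inn (φ y)) (inn (φ z))) to from (λ _ → cong μ* (ψ-Q' z z≢b)) ⟩
      ind (Q'? z ×-dec btw? H* htop (inn (φ y)) (inn (φ z))) (μ* (inn (φ z)))
        ≡⟨ sym (ind-and (Q'? z) (btw? H* htop (inn (φ y)) (inn (φ z))) _) ⟩
      ind (Q'? z) (ind (btw? H* htop (inn (φ y)) (inn (φ z))) (μ* (inn (φ z))))
        ≡⟨ sym (trans (cong (_+ᶻ rest) (ind-no (_≟_ Q z b) z≢b)) (ℤP.+-identityˡ rest)) ⟩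
      ind (_≟_ Q z b) (μ* (ψ z)) +ᶻ ind (Q'? z) (ind (btw? H* htop (inn (φ y)) (inn (φ z))) (μ* (inn (φ z)))) ∎
      where
      rest : ℤ
      rest = ind (Q'? z) (ind (btw? H* htop (inn (φ y)) (inn (φ z))) (μ* (inn (φ z))))
      Q-side H-side : Set
      Q-side = _≼_ Q b z × _≺_ Q z y
      H-side = (proj₂ z < i × ¬ z ≡ b) × (_≼_ H* htop (inn (φ z)) × _≺_ H* (inn (φ z)) (inn (φ y)))
      to : Q-side → H-side
      to (_ , (z≤y , z≢y)) =
        let j'<i = ℕP.≤-<-trans (proj₁ (proj₂ z≤y)) j<i
        in (j'<i , z≢b) , (≤top , (inn≤ (Equivalence.to (φ-antitone y z y∈ z∈ j<i j'<i) z≤y)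
                                   , λ e → z≢y (φ-injective z y j'<i j<i (inn-injective e))))
      from : H-side → Q-side
      from ((j'<i , _) , (_ , (inn≤ φy≤φz , φz≢φy))) =
        b-least z z∈ , (Equivalence.from (φ-antitone y z y∈ z∈ j<i j'<i) φy≤φz , λ e → φz≢φy (cong (λ w → inn (φ w)) e))

  ψ-step : ∀ y → y ∈ elems Q → proj₂ y < i → _≼_ Q b y → ¬ b ≡ y →
    μ* (ψ y) ≡ - ∑ (filter (btw? Q b y) (elems Q)) (λ z → μ* (ψ z))
  ψ-step y y∈ j<i b≤y b≢y = begin
    μ* (ψ y)
      ≡⟨ cong μ* (ψ-Q' y (λ e → b≢y (sym e))) ⟩
    μ* (inn (φ y))
      ≡⟨ MH*.mobius-step htop (inn (φ y)) ≤top (λ ()) ⟩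
    - ∑ (filter under-y? (elems (hat I))) μ*
      ≡⟨ cong -_ (trans (∑-filter under-y? (elems (hat I)) μ*) (∑-hat I (λ w → ind (under-y? w) (μ* w)))) ⟩
    - (ind (under-y? hbot) (μ* hbot) +ᶻ (ind (under-y? htop) (μ* htop) +ᶻ ∑ (elems I) inner))
      ≡⟨ cong -_ (cong₂ _+ᶻ_ (ind-no {u = μ* hbot} (under-y? hbot) (λ { (_ , (() , _)) }))
                              (cong (_+ᶻ ∑ (elems I) inner) (ind-yes {u = μ* htop} (under-y? htop) (≤top , (≤top , λ ()))))) ⟩
    - (0ℤ +ᶻ (μ* htop +ᶻ ∑ (elems I) inner))
      ≡⟨ cong -_ (ℤP.+-identityˡ (μ* htop +ᶻ ∑ (elems I) inner)) ⟩
    - (μ* htop +ᶻ ∑ (elems I) inner)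
      ≡⟨ cong (λ u → - (u +ᶻ ∑ (elems I) inner))
              (trans (cong μ* (sym ψ-b)) (sym (∑-at (_≟_ Q) (elems Q) (λ z → μ* (ψ z)) b unique-Q b∈Q))) ⟩
    - (∑ (elems Q) at-b +ᶻ ∑ (elems I) inner)
      ≡⟨ cong (λ u → - (∑ (elems Q) at-b +ᶻ u)) (sym (reflect-sum inner)) ⟩
    - (∑ (elems Q) at-b +ᶻ ∑ (elems Q) (λ z → ind (Q'? z) (inner (φ z))))
      ≡⟨ cong -_ (sym (∑-+ (elems Q) at-b _)) ⟩
    - ∑ (elems Q) (λ z → at-b z +ᶻ ind (Q'? z) (inner (φ z)))
      ≡⟨ cong -_ (sym (∑-cong (elems Q) (interval-match y y∈ j<i b≤y b≢y))) ⟩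
    - ∑ (elems Q) (λ z → ind (btw? Q b y z) (μ* (ψ z)))
      ≡⟨ cong -_ (sym (∑-filter (btw? Q b y) (elems Q) _)) ⟩
    - ∑ (filter (btw? Q b y) (elems Q)) (λ z → μ* (ψ z)) ∎
    where
    under-y? : ∀ w → Dec (_≼_ H* htop w × _≺_ H* w (inn (φ y)))
    under-y? = btw? H* htop (inn (φ y))
    inner : C × ℕ → ℤ
    inner w = ind (under-y? (inn w)) (μ* (inn w))
    at-b : C × ℕ → ℤ
    at-b z = ind (_≟_ Q z b) (μ* (ψ z))

  μQ-reflect : ∀ z → z ∈ elems Q → proj₂ z < i → ¬ z ≡ b → μQ z ≡ μ* (inn (φ z))
  μQ-reflect z z∈ j<i z≢b = begin
    μQ z            ≡⟨ sym (MQ.mobius-unique b (λ z → proj₂ z < i) (λ z → μ* (ψ z)) ψ-one below-closed ψ-step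
                                              z z∈ j<i (b-least z z∈)) ⟩
    μ* (ψ z)        ≡⟨ cong μ* (ψ-Q' z z≢b) ⟩
    μ* (inn (φ z))  ∎
    where
    ψ-one : μ* (ψ b) ≡ 1ℤ
    ψ-one = trans (cong μ* ψ-b) (MH*.mobius-refl htop)
    below-closed : ∀ y z → proj₂ y < i → _≺_ Q z y → proj₂ z < i
    below-closed y z j<i ((_ , j'≤j , _) , _) = ℕP.≤-<-trans j'≤j j<i

  Y : ℤ
  Y = ∑ (elems I) (λ w → μ* (inn w))

  Q'-sum : ∑ (elems Q) (λ z → ind (Q'? z) (μQ z)) ≡ Y
  Q'-sum = trans (∑-cong (elems Q) (λ z z∈ → ind-cong (Q'? z) (Q'? z) (λ p → p) (λ p → p)
                                       (λ (j<i , z≢b) → μQ-reflect z z∈ j<i z≢b)))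
                 (reflect-sum (λ w → μ* (inn w)))

  -- From ∑_Q μ_Q(b , ·) = 0:  R + (1 + Y) = 0.
  Q-levels : R +ᶻ (1ℤ +ᶻ Y) ≡ 0ℤ
  Q-levels = begin
    R +ᶻ (1ℤ +ᶻ Y)    ≡⟨ trans (ℤP.+-comm R _) (ℤP.+-assoc 1ℤ Y R) ⟩
    1ℤ +ᶻ (Y +ᶻ R)    ≡⟨ cong (λ u → 1ℤ +ᶻ (u +ᶻ R)) (sym Q'-sum) ⟩
    1ℤ +ᶻ (∑ (elems Q) (λ z → ind (Q'? z) (μQ z)) +ᶻ R)  ≡⟨ sym Q-sum-split ⟩
    ∑ (elems Q) μQ    ≡⟨ Q-sum-zero ⟩
    0ℤ                ∎

  -- From ∑ μ*(htop , ·) = 0 over H*, bounded by htop < hbot:  μ*(hbot) + (1 + Y) = 0.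
  H-levels : μ* hbot +ᶻ (1ℤ +ᶻ Y) ≡ 0ℤ
  H-levels = begin
    μ* hbot +ᶻ (1ℤ +ᶻ Y)        ≡⟨ cong (λ u → μ* hbot +ᶻ (u +ᶻ Y)) (sym (MH*.mobius-refl htop)) ⟩
    μ* hbot +ᶻ (μ* htop +ᶻ Y)   ≡⟨ sym (∑-hat I μ*) ⟩
    ∑ (elems (hat I)) μ*        ≡⟨ MH*.mobius-total-sum (unique-hat I unique-I) htop hbot (here refl) bot≤ (λ ())
                                                        (λ _ _ → ≤top , bot≤) ⟩
    0ℤ                          ∎

  μhat-I : μhat I ≡ μ* hbot
  μhat-I = mobius-duality (hat I) (po-hat I po-I) (unique-hat I unique-I) hbot htop (here refl) (there (here refl)) bot≤

corollary4p4 : (P : BoundedRankedPoset) (i : ℕ) → 1 ≤ i → i ≤ BoundedRankedPoset.len P →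
    μhat (Iposet (toR P) (i ∸ 1))
      ≡ sumℤ (map (mobius (Riposet (dualR P) i) (BoundedRankedPoset.top P , 0))
                  (filter (λ z → proj₂ z ≟ℕ i) (elems (Riposet (dualR P) i))))
corollary4p4 P i 1≤i i≤n = begin
  μhat I                                           ≡⟨ μhat-I ⟩
  μ* hbot                                          ≡⟨ inverseˡ-unique (μ* hbot) (1ℤ +ᶻ Y) H-levels ⟩
  - (1ℤ +ᶻ Y)                                      ≡⟨ sym (inverseˡ-unique R (1ℤ +ᶻ Y) Q-levels) ⟩
  R                                                ≡⟨ sym (∑-filter (λ z → proj₂ z ≟ℕ i) (elems Q) μQ) ⟩
  ∑ (filter (λ z → proj₂ z ≟ℕ i) (elems Q)) μQ     ∎
  where open Setting P i 1≤i i≤n
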